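{- Let $(V,Q)$ be a positive definite quadratic space over $\mathbb{Q}$ and let $x_1,x_2\in V$ be linearly independent with Gram matrix $G=(\mathcal{B}(x_i,x_j))_{1\le i,j\le2}\in M_2(\mathbb{Z})$. Then there is $C\in\mathbb{Z}^+$ such that $C\cdot Q(x_1)$ is not represented by $\mathbb{Q}x_1+\mathbb{Q}x_2$. Moreover, one can choose (1) $C=3$ if $\det G$ is a square; (2) $C=\gamma_p$ if $p$ is an odd prime such that $\nu_p(\det G)$ is odd; (3) $C=5$ if $\nu_2(\det G)$ is odd.
   Context: $\mathcal{B}(v,w)=\frac12(Q(v+w)-Q(v)-Q(w))$. For an odd prime $p$, $\gamma_p$ is the least positive quadratic non-residue modulo $p$. $\nu_p$ is the $p$-adic valuation. -}

module Defs where

open import Level using (Level; _⊔_)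
open import Data.Nat as ℕ using (ℕ; zero; suc)
open import Data.Nat.Divisibility using (_∣_)
open import Data.Nat.Primality using (Prime)
open import Data.Integer as ℤ using (ℤ; +_)
open import Data.Rational as ℚ using (ℚ; 0ℚ; ½; _/_)
open import Data.Rational.Properties using (+-*-ring)
open import Data.Fin using (Fin) renaming (zero to f0; suc to fs)
open import Data.Product using (Σ; ∃; ∃-syntax; _×_)
open import Relation.Binary.PropositionalEquality using (_≡_)
open import Relation.Nullary using (¬_)
open import Algebra.Module.Bundles using (LeftModule)

ℚ-Module : (m ℓ : Level) → Set _
ℚ-Module m ℓ = LeftModule +-*-ring m ℓ

ℤ→ℚ : ℤ → ℚ
ℤ→ℚ z = z / 1

ℕ→ℚ : ℕ → ℚ
ℕ→ℚ n = (+ n) / 1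

module _ {m ℓ : Level} (V : ℚ-Module m ℓ) where
  open LeftModule V

  lincomb : (n : ℕ) → (Fin n → ℚ) → (Fin n → Carrierᴹ) → Carrierᴹ
  lincomb zero    c e = 0ᴹ
  lincomb (suc n) c e = (c f0 *ₗ e f0) +ᴹ lincomb n (λ i → c (fs i)) (λ i → e (fs i))

  FiniteDimensional : Set (m ⊔ ℓ)
  FiniteDimensional =
    ∃[ n ] Σ (Fin n → Carrierᴹ) λ e →
      (∀ v → ∃[ c ] (v ≈ᴹ lincomb n c e)) ×
      (∀ c → lincomb n c e ≈ᴹ 0ᴹ → ∀ i → c i ≡ 0ℚ)

  polar : (Carrierᴹ → ℚ) → Carrierᴹ → Carrierᴹ → ℚ
  polar Q v w = ½ ℚ.* ((Q (v +ᴹ w) ℚ.- Q v) ℚ.- Q w)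

  -- Q is a quadratic form: Q(rv) = r² Q(v) and B is bilinear (B is symmetric by construction)
  record IsQuadraticForm (Q : Carrierᴹ → ℚ) : Set (m ⊔ ℓ) where
    field
      Q-cong  : ∀ {v w} → v ≈ᴹ w → Q v ≡ Q w
      Q-scale : ∀ r v → Q (r *ₗ v) ≡ (r ℚ.* r) ℚ.* Q v
      B-linear : ∀ r s u v w →
        polar Q ((r *ₗ u) +ᴹ (s *ₗ v)) w ≡ (r ℚ.* polar Q u w) ℚ.+ (s ℚ.* polar Q v w)

  record IsPosDefQuadraticSpace (Q : Carrierᴹ → ℚ) : Set (m ⊔ ℓ) where
    field
      finiteDim   : FiniteDimensional
      quadratic   : IsQuadraticForm Q
      posDefinite : ∀ v → ¬ (v ≈ᴹ 0ᴹ) → 0ℚ ℚ.< Q v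

  LinearlyIndependent₂ : Carrierᴹ → Carrierᴹ → Set ℓ
  LinearlyIndependent₂ x₁ x₂ =
    ∀ a b → (a *ₗ x₁) +ᴹ (b *ₗ x₂) ≈ᴹ 0ᴹ → (a ≡ 0ℚ) × (b ≡ 0ℚ)

  RepresentedBySpan : (Carrierᴹ → ℚ) → Carrierᴹ → Carrierᴹ → ℚ → Set
  RepresentedBySpan Q x₁ x₂ q = ∃[ a ] ∃[ b ] (Q ((a *ₗ x₁) +ᴹ (b *ₗ x₂)) ≡ q)

det₂ : (Fin 2 → Fin 2 → ℤ) → ℤ
det₂ G = (G f0 f0 ℤ.* G (fs f0) (fs f0)) ℤ.- (G f0 (fs f0) ℤ.* G (fs f0) f0)

IsSquareℤ : ℤ → Set
IsSquareℤ d = ∃[ k ] (d ≡ k ℤ.* k)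

OddNat : ℕ → Set
OddNat k = ∃[ j ] (k ≡ suc (2 ℕ.* j))

OddValuation : ℕ → ℤ → Set
OddValuation p d = ∃[ k ] (OddNat k × (p ℕ.^ k) ∣ ℤ.∣ d ∣ × ¬ ((p ℕ.^ suc k) ∣ ℤ.∣ d ∣))

QuadResidue : ℕ → ℕ → Set
QuadResidue p n = ¬ (p ∣ n) × ∃[ x ] (p ∣ ℤ.∣ (+ (x ℕ.* x)) ℤ.- (+ n) ∣)

QuadNonResidue : ℕ → ℕ → Set
QuadNonResidue p n = ¬ (p ∣ n) × ¬ (∃[ x ] (p ∣ ℤ.∣ (+ (x ℕ.* x)) ℤ.- (+ n) ∣))

IsLeastQNR : ℕ → ℕ → Set
IsLeastQNR p g = (0 ℕ.< g) × QuadNonResidue p g × (∀ h → 0 ℕ.< h → h ℕ.< g → ¬ QuadNonResidue p h)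

{-# OPTIONS --safe #-}
module Submission where

open import Defs
open import Level using (Level)
open import Data.Nat as ℕ using (ℕ)
open import Data.Nat.Primality using (Prime)
open import Data.Integer as ℤ using (ℤ)
open import Data.Rational as ℚ using (ℚ)
open import Data.Fin using (Fin) renaming (zero to f0; suc to fs)
open import Data.Product using (Σ; ∃; ∃-syntax; _×_)
open import Relation.Binary.PropositionalEquality using (_≡_; _≢_)
open import Relation.Nullary using (¬_)
open import Algebra.Module.Bundles using (LeftModule)
open import Data.Product using (_,_; proj₁; proj₂)
import Data.Integer.Properties as ℤ
open import Relation.Binary.PropositionalEquality using (trans; sym; subst; cong)

-- Write g, s, h for the entries of the Gram matrix G and D = gh - s² = det G. Completing the square,
-- g Q(a x₁ + b x₂) = (ga + sb)² + D b², so if C Q(x₁) = C g is represented then X² + D Y² = C Z² has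
-- an integer solution with Z ≠ 0; positive definiteness gives D > 0. A square factor of D can be
-- absorbed into Y, and infinite descent excludes the remaining equations: every solution of
-- X² + Y² = 3 Z² is divisible by 3 (a sum of two squares is divisible by 3 only if both are); every
-- solution of X² + p u Y² = C Z² with p ∤ u and C a non-residue mod p is divisible by p; and reducing
-- X² + 2 u Y² = 5 Z² with u odd mod 8 shows that every solution is even. For the existence of C: a
-- positive non-square has a prime of odd multiplicity, and every odd prime has a non-residue.

module Residues where
  open import Data.Nat
  open import Data.Nat.Properties
  open import Data.Nat.DivMod
  open import Data.Nat.Divisibility
  open import Data.Nat.Primality
  open import Data.Nat.Coprimality using (Coprime; coprime-Bézout)
  open import Data.Nat.GCD using (module Bézout)
  open import Data.Nat.Tactic.RingSolver using (solve)
  open import Data.List using (_∷_; [])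
  open import Data.Fin using (toℕ; fromℕ<)
  open import Data.Fin.Properties using (pigeonhole; fromℕ<-injective; toℕ<n)
  open import Data.Product
  open import Data.Sum
  open import Data.Empty
  open import Relation.Nullary
  open import Relation.Nullary.Decidable using (_×-dec_; ¬?)
  open import Relation.Binary.PropositionalEquality

  module _ {d : ℕ} .{{_ : NonZero d}} where

    %-cong-+ : ∀ {a a′ b b′} → a % d ≡ a′ % d → b % d ≡ b′ % d → (a + b) % d ≡ (a′ + b′) % d
    %-cong-+ {a} {a′} {b} {b′} a≡a′ b≡b′ = begin
      (a + b) % d             ≡⟨ %-distribˡ-+ a b d ⟩
      (a % d + b % d) % d     ≡⟨ cong₂ (λ u v → (u + v) % d) a≡a′ b≡b′ ⟩
      (a′ % d + b′ % d) % d   ≡⟨ %-distribˡ-+ a′ b′ d ⟨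
      (a′ + b′) % d           ∎
      where open ≡-Reasoning

    %-cong-* : ∀ {a a′ b b′} → a % d ≡ a′ % d → b % d ≡ b′ % d → (a * b) % d ≡ (a′ * b′) % d
    %-cong-* {a} {a′} {b} {b′} a≡a′ b≡b′ = begin
      (a * b) % d             ≡⟨ %-distribˡ-* a b d ⟩
      (a % d * (b % d)) % d   ≡⟨ cong₂ (λ u v → (u * v) % d) a≡a′ b≡b′ ⟩
      (a′ % d * (b′ % d)) % d ≡⟨ %-distribˡ-* a′ b′ d ⟨
      (a′ * b′) % d           ∎
      where open ≡-Reasoning

    square-% : ∀ a → (a * a) % d ≡ (a % d * (a % d)) % d
    square-% a = %-cong-* (sym (m%n%n≡m%n a d)) (sym (m%n%n≡m%n a d))

    binaryForm-% : ∀ x K y → (x * x + K * (y * y)) % d ≡ (x % d * (x % d) + K % d * (y % d * (y % d))) % d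
    binaryForm-% x K y = %-cong-+ (square-% x) (%-cong-* (sym (m%n%n≡m%n K d)) (square-% y))

    scaledSquare-% : ∀ C z → (C * (z * z)) % d ≡ (C % d * (z % d * (z % d))) % d
    scaledSquare-% C z = %-cong-* (sym (m%n%n≡m%n C d)) (square-% z)

    private
      ∸-multiple⇒%≡ : ∀ {a b} → b ≤ a → d ∣ a ∸ b → a % d ≡ b % d
      ∸-multiple⇒%≡ {a} {b} b≤a d∣a∸b = begin
        a % d             ≡⟨ cong (_% d) (m+[n∸m]≡n b≤a) ⟨
        (b + (a ∸ b)) % d ≡⟨ %-remove-+ʳ b d∣a∸b ⟩
        b % d             ∎
        where open ≡-Reasoning

      %≡⇒∸-multiple : ∀ {a b} → b ≤ a → a % d ≡ b % d → d ∣ a ∸ b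
      %≡⇒∸-multiple {a} {b} b≤a a≡b = divides (a / d ∸ b / d) (begin
        a ∸ b                                     ≡⟨ cong₂ _∸_ (m≡m%n+[m/n]*n a d) (m≡m%n+[m/n]*n b d) ⟩
        (a % d + a / d * d) ∸ (b % d + b / d * d) ≡⟨ cong (λ r → (r + a / d * d) ∸ (b % d + b / d * d)) a≡b ⟩
        (b % d + a / d * d) ∸ (b % d + b / d * d) ≡⟨ [m+n]∸[m+o]≡n∸o (b % d) (a / d * d) (b / d * d) ⟩
        a / d * d ∸ b / d * d                     ≡⟨ *-distribʳ-∸ d (a / d) (b / d) ⟨
        (a / d ∸ b / d) * d                       ∎)
        where open ≡-Reasoning

    ∣∣m-n∣⇒%≡ : ∀ {a b} → d ∣ ∣ a - b ∣ → a % d ≡ b % d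
    ∣∣m-n∣⇒%≡ {a} {b} d∣ with ≤-total b a
    ... | inj₁ b≤a = ∸-multiple⇒%≡ b≤a (subst (d ∣_) (trans (∣-∣-comm a b) (m≤n⇒∣m-n∣≡n∸m b≤a)) d∣)
    ... | inj₂ a≤b = sym (∸-multiple⇒%≡ a≤b (subst (d ∣_) (m≤n⇒∣m-n∣≡n∸m a≤b) d∣))

    %≡⇒∣∣m-n∣ : ∀ {a b} → a % d ≡ b % d → d ∣ ∣ a - b ∣
    %≡⇒∣∣m-n∣ {a} {b} a≡b with ≤-total b a
    ... | inj₁ b≤a = subst (d ∣_) (sym (trans (∣-∣-comm a b) (m≤n⇒∣m-n∣≡n∸m b≤a))) (%≡⇒∸-multiple b≤a a≡b)
    ... | inj₂ a≤b = subst (d ∣_) (sym (m≤n⇒∣m-n∣≡n∸m a≤b)) (%≡⇒∸-multiple a≤b (sym a≡b))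

  ∣m⊖n∣≡∣m-n∣ : ∀ m n → ℤ.∣ m ℤ.⊖ n ∣ ≡ ∣ m - n ∣
  ∣m⊖n∣≡∣m-n∣ zero    zero    = refl
  ∣m⊖n∣≡∣m-n∣ zero    (suc n) = refl
  ∣m⊖n∣≡∣m-n∣ (suc m) zero    = refl
  ∣m⊖n∣≡∣m-n∣ (suc m) (suc n) = trans (cong ℤ.∣_∣ (ℤ.[1+m]⊖[1+n]≡m⊖n m n)) (∣m⊖n∣≡∣m-n∣ m n)

  ∣[+m]-[+n]∣≡∣m-n∣ : ∀ m n → ℤ.∣ ℤ.+ m ℤ.- ℤ.+ n ∣ ≡ ∣ m - n ∣
  ∣[+m]-[+n]∣≡∣m-n∣ m n = trans (cong ℤ.∣_∣ (ℤ.[+m]-[+n]≡m⊖n m n)) (∣m⊖n∣≡∣m-n∣ m n)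

  prime∤⇒coprime : ∀ {p n} → Prime p → ¬ p ∣ n → Coprime p n
  prime∤⇒coprime pp p∤n (d∣p , d∣n) with prime⇒irreducible pp d∣p
  ... | inj₁ d≡1  = d≡1
  ... | inj₂ refl = contradiction d∣n p∤n

  HasSquareRoot : (p : ℕ) .{{_ : NonZero p}} → ℕ → Set
  HasSquareRoot p h = ∃[ x ] x < p × (x * x) % p ≡ h % p

  hasSquareRoot? : ∀ p .{{_ : NonZero p}} h → Dec (HasSquareRoot p h)
  hasSquareRoot? p h = anyUpTo? (λ x → (x * x) % p ≟ h % p) p

  module _ {p : ℕ} .{{_ : NonZero p}} where

    quadNonResidue⇒%≢ : ∀ {g} → QuadNonResidue p g → ∀ x → (x * x) % p ≢ g % p
    quadNonResidue⇒%≢ {g} (_ , no-root) x x²≡g =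
      no-root (x , subst (p ∣_) (sym (∣[+m]-[+n]∣≡∣m-n∣ (x * x) g)) (%≡⇒∣∣m-n∣ x²≡g))

    ¬hasSquareRoot⇒quadNonResidue : ∀ {g} → ¬ p ∣ g → ¬ HasSquareRoot p g → QuadNonResidue p g
    ¬hasSquareRoot⇒quadNonResidue {g} p∤g no-root = p∤g , λ (x , p∣x²-g) →
      no-root (x % p , m%n<n x p ,
        trans (sym (square-% x)) (∣∣m-n∣⇒%≡ (subst (p ∣_) (∣[+m]-[+n]∣≡∣m-n∣ (x * x) g) p∣x²-g)))

    ≡-1⇒square≡1 : ∀ {a k} → 1 + a ≡ k * p → (a * a) % p ≡ 1 % p
    ≡-1⇒square≡1 {a} {k} 1+a≡kp = begin
      (a * a) % p               ≡⟨ [m+kn]%n≡m%n (a * a) (2 * k) p ⟨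
      (a * a + 2 * k * p) % p   ≡⟨ cong (_% p) (begin
        a * a + 2 * k * p       ≡⟨ solve (a ∷ k ∷ p ∷ []) ⟩
        a * a + 2 * (k * p)     ≡⟨ cong (λ t → a * a + 2 * t) 1+a≡kp ⟨
        a * a + 2 * (1 + a)     ≡⟨ solve (a ∷ []) ⟩
        1 + (1 + a) * (1 + a)   ≡⟨ cong (λ t → 1 + t * t) 1+a≡kp ⟩
        1 + (k * p) * (k * p)   ≡⟨ solve (k ∷ p ∷ []) ⟩
        1 + k * k * p * p       ∎) ⟩
      (1 + k * k * p * p) % p   ≡⟨ [m+kn]%n≡m%n 1 (k * k * p) p ⟩
      1 % p                     ∎
      where open ≡-Reasoning

    ≡1⇒square≡1 : ∀ {a k} → 1 + k * p ≡ a → (a * a) % p ≡ 1 % p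
    ≡1⇒square≡1 {a} {k} 1+kp≡a = begin
      (a * a) % p                     ≡⟨ cong (λ t → (t * t) % p) 1+kp≡a ⟨
      ((1 + k * p) * (1 + k * p)) % p ≡⟨ cong (_% p) (solve (k ∷ p ∷ [])) ⟩
      (1 + (2 + k * p) * k * p) % p   ≡⟨ [m+kn]%n≡m%n 1 ((2 + k * p) * k) p ⟩
      1 % p                           ∎
      where open ≡-Reasoning

    ∃-square-inverse : ∀ {z} → Prime p → ¬ p ∣ z → ∃[ w ] ((z * w) * (z * w)) % p ≡ 1 % p
    ∃-square-inverse {z} pp p∤z with coprime-Bézout (prime∤⇒coprime pp p∤z)
    ... | Bézout.+- k w eq = w , ≡-1⇒square≡1 {k = k} (trans (cong suc (*-comm z w)) eq)
    ... | Bézout.-+ k w eq = w , ≡1⇒square≡1 {k = k} (trans eq (*-comm w z))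

  module _ (r : ℕ) where

    private
      p : ℕ
      p = 3 + r

    -- Since (p - 1)² ≡ 1², a root can be chosen among 1, …, p - 2.
    root-below-p-1 : ∀ {h} → 0 < h → h < p → HasSquareRoot p h →
                     ∃[ v ] v < 1 + r × (suc v * suc v) % p ≡ h % p
    root-below-p-1 0<h h<p (zero , _ , 0≡h) = contradiction (trans 0≡h (m<n⇒m%n≡m h<p)) (<⇒≢ 0<h)
    root-below-p-1 0<h h<p (suc x , x<p , x²≡h) with x ≟ 1 + r
    ... | yes refl = 0 , z<s , trans (sym (≡-1⇒square≡1 {p = p} {k = 1} (sym (*-identityˡ p)))) x²≡h
    ... | no x≢1+r = x , ≤∧≢⇒< (s≤s⁻¹ (s≤s⁻¹ x<p)) x≢1+r , x²≡h

    -- The p - 1 nonzero residues would need distinct roots among p - 2 candidates.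
    ¬all-nonzero-residues-square : ¬ (∀ {h} → 0 < h → h < p → HasSquareRoot p h)
    ¬all-nonzero-residues-square all-square =
      let i , j , i<j , same-index = pigeonhole (n<1+n (1 + r)) root-index
      in <⇒≢ i<j (suc-injective (same-root⇒same-residue i j (fromℕ<-injective _ _ _ _ same-index)))
      where
      h : Fin (2 + r) → ℕ
      h i = suc (toℕ i)
      h<p : ∀ i → h i < p
      h<p i = s≤s (toℕ<n i)
      root : ∀ i → ∃[ v ] v < 1 + r × (suc v * suc v) % p ≡ h i % p
      root i = root-below-p-1 z<s (h<p i) (all-square z<s (h<p i))
      root-index : Fin (2 + r) → Fin (1 + r)
      root-index i = fromℕ< (proj₁ (proj₂ (root i)))
      same-root⇒same-residue : ∀ i j → proj₁ (root i) ≡ proj₁ (root j) → h i ≡ h j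
      same-root⇒same-residue i j vᵢ≡vⱼ = begin
        h i                                               ≡⟨ m<n⇒m%n≡m (h<p i) ⟨
        h i % p                                           ≡⟨ proj₂ (proj₂ (root i)) ⟨
        (suc (proj₁ (root i)) * suc (proj₁ (root i))) % p ≡⟨ cong (λ v → (suc v * suc v) % p) vᵢ≡vⱼ ⟩
        (suc (proj₁ (root j)) * suc (proj₁ (root j))) % p ≡⟨ proj₂ (proj₂ (root j)) ⟩
        h j % p                                           ≡⟨ m<n⇒m%n≡m (h<p j) ⟩
        h j                                               ∎
        where open ≡-Reasoning

  ∃-quadNonResidue : ∀ {p} → Prime p → p ≢ 2 → ∃[ g ] QuadNonResidue p g
  ∃-quadNonResidue {2} _ p≢2 = contradiction refl p≢2
  ∃-quadNonResidue {p@(suc (suc (suc r)))} _ _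
    with anyUpTo? (λ h → 0 <? h ×-dec ¬? (hasSquareRoot? p h)) p
  ... | yes (g , g<p , 0<g , no-root) = g , ¬hasSquareRoot⇒quadNonResidue (>⇒∤ {{>-nonZero 0<g}} g<p) no-root
  ... | no no-nonsquare = ⊥-elim (¬all-nonzero-residues-square r all-square)
    where
    all-square : ∀ {h} → 0 < h → h < p → HasSquareRoot p h
    all-square {h} 0<h h<p with hasSquareRoot? p h
    ... | yes root   = root
    ... | no no-root = contradiction (h , h<p , 0<h , no-root) no-nonsquare

open Residues

module SquareClasses where
  open import Data.Nat
  open import Data.Nat.Properties
  open import Data.Nat.Divisibility
  open import Data.Nat.Primality
  open import Data.Nat.Primality.Factorisation using (factorise)
  open import Data.Nat.ListAction using (product)
  open import Data.Nat.Induction using (<-rec)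
  open import Data.Nat.Tactic.RingSolver using (solve-∀)
  open import Data.List using (_∷_; [])
  open import Data.List.Relation.Unary.All using (_∷_)
  open import Data.Product
  open import Data.Sum
  open import Function using (case_of_)
  open import Relation.Nullary
  open import Relation.Binary.PropositionalEquality

  IsSquare : ℕ → Set
  IsSquare n = ∃[ k ] n ≡ k * k

  -- Equivalent to ν_p(n) being odd; P need not be a power of p.
  OddMultiplicity : ℕ → ℕ → Set
  OddMultiplicity p n = ∃[ u ] ∃[ P ] ¬ p ∣ u × n ≡ p * u * (P * P)

  oddValuation⇒oddMultiplicity : ∀ {p n} → OddValuation p (ℤ.+ n) → OddMultiplicity p n
  oddValuation⇒oddMultiplicity {p} {n} (.(suc (2 * j)) , (j , refl) , divides u n≡u*p^k , p^k+1∤n) =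
    u , p ^ j , p∤u , (begin
      n                               ≡⟨ n≡u*p^k ⟩
      u * (p * p ^ (j + (j + 0)))     ≡⟨ cong (λ t → u * (p * t)) (^-distribˡ-+-* p j (j + 0)) ⟩
      u * (p * (p ^ j * p ^ (j + 0))) ≡⟨ cong (λ e → u * (p * (p ^ j * p ^ e))) (+-identityʳ j) ⟩
      u * (p * (p ^ j * p ^ j))       ≡⟨ rearrange u p (p ^ j * p ^ j) ⟩
      p * u * (p ^ j * p ^ j)         ∎)
    where
    open ≡-Reasoning
    rearrange : ∀ u p P → u * (p * P) ≡ p * u * P
    rearrange = solve-∀
    p∤u : ¬ p ∣ u
    p∤u (divides v refl) = p^k+1∤n (divides v (trans n≡u*p^k (*-assoc v p _)))

  ∃-prime-divisor : ∀ {n} → 1 < n → ∃[ p ] Prime p × p ∣ n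
  ∃-prime-divisor {n} 1<n with factorise n {{>-nonZero (<-trans z<s 1<n)}}
  ... | record { factors = [] ; isFactorisation = n≡1 } = contradiction n≡1 (>⇒≢ 1<n)
  ... | record { factors = p ∷ ps ; isFactorisation = n≡p*ps ; factorsPrime = pp ∷ _ } =
    p , pp , divides (product ps) (trans n≡p*ps (*-comm p _))

  SquareOrOddMultiplicity : ℕ → Set
  SquareOrOddMultiplicity n = IsSquare n ⊎ ∃[ p ] Prime p × OddMultiplicity p n

  squareOrOddMultiplicity-*² : ∀ {k} p → SquareOrOddMultiplicity k → SquareOrOddMultiplicity (k * p * p)
  squareOrOddMultiplicity-*² p (inj₁ (s , refl)) = inj₁ (s * p , identity s p)
    where
    identity : ∀ s p → s * s * p * p ≡ s * p * (s * p)
    identity = solve-∀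
  squareOrOddMultiplicity-*² p (inj₂ (q , qq , u , P , q∤u , refl)) =
    inj₂ (q , qq , u , P * p , q∤u , identity q u P p)
    where
    identity : ∀ q u P p → q * u * (P * P) * p * p ≡ q * u * (P * p * (P * p))
    identity = solve-∀

  square⊎oddMultiplicity : ∀ n → SquareOrOddMultiplicity n
  square⊎oddMultiplicity = <-rec SquareOrOddMultiplicity step
    where
    step : ∀ n → (∀ {m} → m < n → SquareOrOddMultiplicity m) → SquareOrOddMultiplicity n
    step 0 _ = inj₁ (0 , refl)
    step 1 _ = inj₁ (1 , refl)
    step n@(suc (suc _)) smaller with ∃-prime-divisor {n} (s≤s (s≤s z≤n))
    ... | p , pp , divides m n≡m*p with p ∣? m
    ...   | no p∤m = inj₂ (p , pp , m , 1 , p∤m , trans n≡m*p (trans (*-comm m p) (sym (*-identityʳ (p * m)))))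
    ...   | yes (divides k refl) =
      subst SquareOrOddMultiplicity (sym n≡m*p) (squareOrOddMultiplicity-*² p (smaller k<n))
      where
      1<p : 1 < p
      1<p = nonTrivial⇒n>1 p {{prime⇒nonTrivial pp}}
      instance
        k≢0 : NonZero k
        k≢0 = ≢-nonZero λ { refl → case n≡m*p of λ () }
      k<n : k < n
      k<n = subst (k <_) (sym n≡m*p) (<-≤-trans (m<m*n k p 1<p) (m≤m*n (k * p) p {{>-nonZero (<-trans z<s 1<p)}}))

open SquareClasses

module Descent where
  open import Data.Nat
  open import Data.Nat.Properties
  open import Data.Nat.DivMod
  open import Data.Nat.Divisibility
  open import Data.Nat.Primality
  open import Data.Nat.Induction using (<-rec)
  open import Data.Nat.Tactic.RingSolver using (solve-∀; solve)
  open import Data.List using (_∷_; [])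
  open import Data.Product
  open import Data.Sum
  open import Data.Empty
  open import Data.Unit using (tt)
  open import Relation.Nullary
  open import Relation.Nullary.Decidable using (toWitness; _→-dec_; _×-dec_; ¬?)
  open import Relation.Binary.PropositionalEquality

  NoSolution : ℕ → ℕ → Set
  NoSolution K C = ∀ x y z → z ≢ 0 → x * x + K * (y * y) ≢ C * (z * z)

  SolutionsDivisibleBy : ℕ → ℕ → ℕ → Set
  SolutionsDivisibleBy q K C = ∀ {x y z} → x * x + K * (y * y) ≡ C * (z * z) → q ∣ x × q ∣ y × q ∣ z

  descent : ∀ {q K C} → 1 < q → SolutionsDivisibleBy q K C → NoSolution K C
  descent {q} {K} {C} 1<q divisible x y z = <-rec NoSolutionWith go z x y
    where
    instance
      q≢0 : NonZero q
      q≢0 = >-nonZero (<-trans z<s 1<q)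
      q²≢0 : NonZero (q * q)
      q²≢0 = m*n≢0 q q
    NoSolutionWith : ℕ → Set
    NoSolutionWith z = ∀ x y → z ≢ 0 → x * x + K * (y * y) ≢ C * (z * z)
    go : ∀ z → (∀ {z′} → z′ < z → NoSolutionWith z′) → NoSolutionWith z
    go z smaller x y z≢0 eq with divisible {x} {y} {z} eq
    ... | divides x′ refl , divides y′ refl , divides z′ refl =
      smaller (m<m*n z′ q {{≢-nonZero z′≢0}} 1<q) x′ y′ z′≢0 (*-cancelˡ-≡ _ _ (q * q) (begin
        q * q * (x′ * x′ + K * (y′ * y′))           ≡⟨ solve (q ∷ x′ ∷ y′ ∷ K ∷ []) ⟩
        x′ * q * (x′ * q) + K * (y′ * q * (y′ * q)) ≡⟨ eq ⟩
        C * (z′ * q * (z′ * q))                     ≡⟨ solve (q ∷ z′ ∷ C ∷ []) ⟩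
        q * q * (C * (z′ * z′))                     ∎))
      where
      open ≡-Reasoning
      z′≢0 : z′ ≢ 0
      z′≢0 refl = z≢0 refl

  prime∣x²⇒prime∣x : ∀ {p x} → Prime p → p ∣ x * x → p ∣ x
  prime∣x²⇒prime∣x {p} {x} pp p∣x² = reduce (euclidsLemma x x pp p∣x²)

  solutionsDivisibleBy-3 : SolutionsDivisibleBy 3 1 3
  solutionsDivisibleBy-3 {x} {y} {z} eq = 3∣x , 3∣y , 3∣z
    where
    residues-zero : ∀ {r} → r < 3 → ∀ {s} → s < 3 → (r * r + 1 * (s * s)) % 3 ≡ 0 → r ≡ 0 × s ≡ 0
    residues-zero = toWitness {a? = allUpTo? (λ r → allUpTo? (λ s →
      ((r * r + 1 * (s * s)) % 3 ≟ 0) →-dec (r ≟ 0 ×-dec s ≟ 0)) 3) 3} tt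
    3∣x²+y² : (x % 3 * (x % 3) + 1 * (y % 3 * (y % 3))) % 3 ≡ 0
    3∣x²+y² = trans (sym (binaryForm-% x 1 y)) (trans (cong (_% 3) eq) (n∣m⇒m%n≡0 _ 3 (m∣m*n (z * z))))
    x%3≡0×y%3≡0 : x % 3 ≡ 0 × y % 3 ≡ 0
    x%3≡0×y%3≡0 = residues-zero (m%n<n x 3) (m%n<n y 3) 3∣x²+y²
    3∣x : 3 ∣ x
    3∣x = m%n≡0⇒n∣m x 3 (proj₁ x%3≡0×y%3≡0)
    3∣y : 3 ∣ y
    3∣y = m%n≡0⇒n∣m y 3 (proj₂ x%3≡0×y%3≡0)
    3∣z : 3 ∣ z
    3∣z with 3∣x | 3∣y
    ... | divides a refl | divides b refl = prime∣x²⇒prime∣x (toWitness {a? = prime? 3} tt)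
      (divides (a * a + b * b) (*-cancelˡ-≡ _ _ 3 (begin
        3 * (z * z)                             ≡⟨ eq ⟨
        a * 3 * (a * 3) + 1 * (b * 3 * (b * 3)) ≡⟨ solve (a ∷ b ∷ []) ⟩
        3 * ((a * a + b * b) * 3)               ∎)))
      where open ≡-Reasoning

  p∣z⇒p∣x×p∣y : ∀ {p u C x y z} → Prime p → ¬ p ∣ u → p ∣ z →
                x * x + p * u * (y * y) ≡ C * (z * z) → p ∣ x × p ∣ y
  p∣z⇒p∣x×p∣y {p} {u} {C} {x} {y} {z} pp p∤u (divides z′ refl) eq = p∣x , p∣y
    where
    instance
      p≢0 : NonZero p
      p≢0 = prime⇒nonZero pp
    p²∣lhs : p * p ∣ x * x + p * u * (y * y)
    p²∣lhs = divides (C * (z′ * z′)) (trans eq (solve (C ∷ z′ ∷ p ∷ [])))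
    p∣x : p ∣ x
    p∣x = prime∣x²⇒prime∣x pp (∣m+n∣m⇒∣n (subst (p ∣_) (+-comm (x * x) _) (∣-trans (n∣m*n p) p²∣lhs))
                                          (∣m⇒∣m*n (y * y) (m∣m*n u)))
    p∣y : p ∣ y
    p∣y with euclidsLemma u (y * y) pp
               (*-cancelˡ-∣ p (subst (p * p ∣_) (*-assoc p u (y * y)) (∣m+n∣m⇒∣n p²∣lhs (*-pres-∣ p∣x p∣x))))
    ... | inj₁ p∣u  = contradiction p∣u p∤u
    ... | inj₂ p∣y² = prime∣x²⇒prime∣x pp p∣y²

  solutionsDivisibleBy-prime : ∀ {p u g} → Prime p → ¬ p ∣ u → QuadNonResidue p g →
                               SolutionsDivisibleBy p (p * u) g
  solutionsDivisibleBy-prime {p} {u} {g} pp p∤u g-nonresidue {x} {y} {z} eq =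
    proj₁ p∣x×p∣y , proj₂ p∣x×p∣y , p∣z
    where
    instance
      p≢0 : NonZero p
      p≢0 = prime⇒nonZero pp
    x²≡gz² : (x * x) % p ≡ (g * (z * z)) % p
    x²≡gz² = trans (sym (%-remove-+ʳ (x * x) (∣m⇒∣m*n (y * y) (m∣m*n u)))) (cong (_% p) eq)
    -- Otherwise (x w)² ≡ g (z w)² ≡ g, where (z w)² ≡ 1.
    p∣z : p ∣ z
    p∣z with p ∣? z
    ... | yes p∣z = p∣z
    ... | no p∤z with ∃-square-inverse pp p∤z
    ...   | w , [zw]²≡1 = contradiction (begin
      (x * w * (x * w)) % p       ≡⟨ cong (_% p) (solve (x ∷ w ∷ [])) ⟩
      (x * x * (w * w)) % p       ≡⟨ %-cong-* {d = p} x²≡gz² refl ⟩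
      (g * (z * z) * (w * w)) % p ≡⟨ cong (_% p) (solve (g ∷ z ∷ w ∷ [])) ⟩
      (g * (z * w * (z * w))) % p ≡⟨ %-cong-* {d = p} {a = g} refl [zw]²≡1 ⟩
      (g * 1) % p                 ≡⟨ cong (_% p) (*-identityʳ g) ⟩
      g % p                       ∎) (quadNonResidue⇒%≢ g-nonresidue (x * w))
      where open ≡-Reasoning
    p∣x×p∣y : p ∣ x × p ∣ y
    p∣x×p∣y = p∣z⇒p∣x×p∣y {C = g} pp p∤u p∣z eq

  solutionsDivisibleBy-2 : ∀ {u} → ¬ 2 ∣ u → SolutionsDivisibleBy 2 (2 * u) 5
  solutionsDivisibleBy-2 {u} 2∤u {x} {y} {z} eq = proj₁ 2∣x×2∣y , proj₂ 2∣x×2∣y , 2∣z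
    where
    lhs-≢5 : ∀ {a} → a < 8 → ∀ {b} → b < 8 → ∀ {c} → c < 8 → 2 ∣ c → ¬ 4 ∣ c → (a * a + c * (b * b)) % 8 ≢ 5
    lhs-≢5 = toWitness {a? = allUpTo? (λ a → allUpTo? (λ b → allUpTo? (λ c →
      2 ∣? c →-dec ¬? (4 ∣? c) →-dec ¬? ((a * a + c * (b * b)) % 8 ≟ 5)) 8) 8) 8} tt
    rhs-≡5 : ∀ {e} → e < 8 → ¬ 2 ∣ e → (5 * (e * e)) % 8 ≡ 5
    rhs-≡5 = toWitness {a? = allUpTo? (λ e → ¬? (2 ∣? e) →-dec ((5 * (e * e)) % 8 ≟ 5)) 8} tt
    2∣2u%8 : 2 ∣ (2 * u) % 8
    2∣2u%8 = %-presˡ-∣ (m∣m*n u) (divides 4 refl)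
    4∤2u%8 : ¬ 4 ∣ (2 * u) % 8
    4∤2u%8 4∣2u%8 = 2∤u (*-cancelˡ-∣ 2 (∣n∣m%n⇒∣m (divides 2 refl) 4∣2u%8))
    2∤z%8 : ¬ 2 ∣ z → ¬ 2 ∣ z % 8
    2∤z%8 2∤z 2∣z%8 = 2∤z (∣n∣m%n⇒∣m (divides 4 refl) 2∣z%8)
    2∣z : 2 ∣ z
    2∣z with 2 ∣? z
    ... | yes 2∣z = 2∣z
    ... | no 2∤z = ⊥-elim (lhs-≢5 (m%n<n x 8) (m%n<n y 8) (m%n<n (2 * u) 8) 2∣2u%8 4∤2u%8 (begin
      (x % 8 * (x % 8) + (2 * u) % 8 * (y % 8 * (y % 8))) % 8 ≡⟨ binaryForm-% x (2 * u) y ⟨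
      (x * x + 2 * u * (y * y)) % 8                          ≡⟨ cong (_% 8) eq ⟩
      (5 * (z * z)) % 8                                      ≡⟨ scaledSquare-% 5 z ⟩
      (5 * (z % 8 * (z % 8))) % 8                            ≡⟨ rhs-≡5 (m%n<n z 8) (2∤z%8 2∤z) ⟩
      5                                                      ∎))
      where open ≡-Reasoning
    2∣x×2∣y : 2 ∣ x × 2 ∣ y
    2∣x×2∣y = p∣z⇒p∣x×p∣y {C = 5} prime[2] 2∤u 2∣z eq

  noSolution-*² : ∀ {K C} P → NoSolution K C → NoSolution (K * (P * P)) C
  noSolution-*² {K} P no-solution x y z z≢0 eq =
    no-solution x (P * y) z z≢0 (trans (cong ((x * x) +_) (identity K P y)) eq)
    where
    identity : ∀ K P y → K * (P * y * (P * y)) ≡ K * (P * P) * (y * y)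
    identity = solve-∀

  noSolution-oddMultiplicity : ∀ {p n C} → OddMultiplicity p n →
                               (∀ {u} → ¬ p ∣ u → NoSolution (p * u) C) → NoSolution n C
  noSolution-oddMultiplicity {p} {C = C} (u , P , p∤u , refl) no-solution =
    noSolution-*² {p * u} {C} P (no-solution p∤u)

  noSolution-square-3 : ∀ k → NoSolution (k * k) 3
  noSolution-square-3 k = subst (λ K → NoSolution K 3) (*-identityˡ (k * k))
    (noSolution-*² {1} {3} k (descent {3} {1} {3} (s≤s (s≤s z≤n)) solutionsDivisibleBy-3))

  noSolution-nonResidue : ∀ {p n g} → Prime p → OddMultiplicity p n → QuadNonResidue p g → NoSolution n g
  noSolution-nonResidue {p} {g = g} pp odd g-nonresidue =
    noSolution-oddMultiplicity {C = g} odd λ {u} p∤u → descent {p} {p * u} {g}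
      (nonTrivial⇒n>1 p {{prime⇒nonTrivial pp}}) (solutionsDivisibleBy-prime pp p∤u g-nonresidue)

  noSolution-2-5 : ∀ {n} → OddMultiplicity 2 n → NoSolution n 5
  noSolution-2-5 odd = noSolution-oddMultiplicity {C = 5} odd λ {u} 2∤u →
    descent {2} {2 * u} {5} (s≤s (s≤s z≤n)) (solutionsDivisibleBy-2 2∤u)

  ∃-noSolution : ∀ n → ∃[ C ] 0 < C × NoSolution n C
  ∃-noSolution n with square⊎oddMultiplicity n
  ... | inj₁ (k , refl) = 3 , z<s , noSolution-square-3 k
  ... | inj₂ (p , pp , odd) with p ≟ 2
  ...   | yes refl = 5 , z<s , noSolution-2-5 odd
  ...   | no p≢2 with ∃-quadNonResidue pp p≢2
  ...     | g , g-nonresidue@(p∤g , _) =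
    g , n≢0⇒n>0 (λ { refl → p∤g (p ∣0) }) , noSolution-nonResidue pp odd g-nonresidue

open Descent

module Rationals where
  open import Data.Nat.Base as ℕ using (suc)
  import Data.Nat.Properties as ℕ
  import Data.Nat.Coprimality as ℕ
  open import Data.Integer.Tactic.RingSolver using (solve-∀)
  open import Data.Rational using (mkℚ; ↥_; ↧_; 0ℚ; _+_; _*_; _-_; -_)
  import Data.Rational.Properties as ℚ
  import Data.Rational.Unnormalised as ℚᵘ
  import Data.Rational.Unnormalised.Properties as ℚᵘ
  open import Data.Rational.Solver using (module +-*-Solver)
  open import Relation.Binary.PropositionalEquality
  open import Function using (_∘_)
  open +-*-Solver

  coprime-1 : ∀ n → ℕ.Coprime n 1
  coprime-1 n = ℕ.sym (ℕ.1-coprimeTo n)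

  ℤ→ℚ≡mkℚ : ∀ i → ℤ→ℚ i ≡ mkℚ i 0 (coprime-1 ℤ.∣ i ∣)
  ℤ→ℚ≡mkℚ (ℤ.+ n)    = ℚ.normalize-coprime (coprime-1 n)
  ℤ→ℚ≡mkℚ ℤ.-[1+ n ] = cong -_ (ℚ.normalize-coprime (coprime-1 (suc n)))

  ↥-ℤ→ℚ : ∀ i → ↥ ℤ→ℚ i ≡ i
  ↥-ℤ→ℚ i = cong ↥_ (ℤ→ℚ≡mkℚ i)

  ℤ→ℚ-injective : ∀ {i j} → ℤ→ℚ i ≡ ℤ→ℚ j → i ≡ j
  ℤ→ℚ-injective {i} {j} eq = trans (sym (↥-ℤ→ℚ i)) (trans (cong ↥_ eq) (↥-ℤ→ℚ j))

  ℤ→ℚ-* : ∀ i j → ℤ→ℚ (i ℤ.* j) ≡ ℤ→ℚ i * ℤ→ℚ j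
  ℤ→ℚ-* i j rewrite ℤ→ℚ≡mkℚ i | ℤ→ℚ≡mkℚ j = refl

  ℤ→ℚ-+ : ∀ i j → ℤ→ℚ (i ℤ.+ j) ≡ ℤ→ℚ i + ℤ→ℚ j
  ℤ→ℚ-+ i j rewrite ℤ→ℚ≡mkℚ i | ℤ→ℚ≡mkℚ j = cong ℤ→ℚ (identity i j)
    where
    identity : ∀ i j → i ℤ.+ j ≡ i ℤ.* ℤ.+ 1 ℤ.+ j ℤ.* ℤ.+ 1
    identity = solve-∀

  ℤ→ℚ-neg : ∀ i → ℤ→ℚ (ℤ.- i) ≡ - ℤ→ℚ i
  ℤ→ℚ-neg i rewrite ℤ→ℚ≡mkℚ i | ℤ→ℚ≡mkℚ (ℤ.- i) = mkℚ-neg i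
    where
    mkℚ-neg : ∀ i → mkℚ (ℤ.- i) 0 (coprime-1 ℤ.∣ ℤ.- i ∣) ≡ - mkℚ i 0 (coprime-1 ℤ.∣ i ∣)
    mkℚ-neg (ℤ.+ 0)     = refl
    mkℚ-neg (ℤ.+ suc n) = refl
    mkℚ-neg ℤ.-[1+ n ]  = refl

  ℤ→ℚ-minus : ∀ i j → ℤ→ℚ (i ℤ.- j) ≡ ℤ→ℚ i - ℤ→ℚ j
  ℤ→ℚ-minus i j = trans (ℤ→ℚ-+ i (ℤ.- j)) (cong (ℤ→ℚ i +_) (ℤ→ℚ-neg j))

  ℤ→ℚ-cancel-< : ∀ i → 0ℚ ℚ.< ℤ→ℚ i → ℤ.0ℤ ℤ.< i
  ℤ→ℚ-cancel-< i 0<i rewrite ℤ→ℚ≡mkℚ i with 0<i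
  ... | ℚ.*<* 0<i*1 = subst (ℤ.0ℤ ℤ.<_) (ℤ.*-identityʳ i) 0<i*1

  *↧≡↥ : ∀ q → q * ℤ→ℚ (↧ q) ≡ ℤ→ℚ (↥ q)
  *↧≡↥ q@(mkℚ n d-1 _) = ℚ.toℚᵘ-injective (ℚᵘ.≃-trans (ℚ.toℚᵘ-homo-* q (ℤ→ℚ (↧ q))) unnormalised)
    where
    unnormalised : ℚᵘ.mkℚᵘ n d-1 ℚᵘ.* ℚ.toℚᵘ (ℤ→ℚ (↧ q)) ℚᵘ.≃ ℚ.toℚᵘ (ℤ→ℚ n)
    unnormalised rewrite ℤ→ℚ≡mkℚ (↧ q) | ℤ→ℚ≡mkℚ n | ℕ.*-identityʳ d-1 = ℚᵘ.*≡* (ℤ.*-identityʳ _)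

  ℕ→ℚ-+ : ∀ m n → ℕ→ℚ (m ℕ.+ n) ≡ ℕ→ℚ m + ℕ→ℚ n
  ℕ→ℚ-+ m n = trans (cong ℤ→ℚ (ℤ.pos-+ m n)) (ℤ→ℚ-+ (ℤ.+ m) (ℤ.+ n))

  ℕ→ℚ-* : ∀ m n → ℕ→ℚ (m ℕ.* n) ≡ ℕ→ℚ m * ℕ→ℚ n
  ℕ→ℚ-* m n = trans (cong ℤ→ℚ (ℤ.pos-* m n)) (ℤ→ℚ-* (ℤ.+ m) (ℤ.+ n))

  ℕ→ℚ-injective : ∀ {m n} → ℕ→ℚ m ≡ ℕ→ℚ n → m ≡ n
  ℕ→ℚ-injective eq = ℤ.+-injective (ℤ→ℚ-injective eq)

  i*i≡+∣i∣*∣i∣ : ∀ i → i ℤ.* i ≡ ℤ.+ (ℤ.∣ i ∣ ℕ.* ℤ.∣ i ∣)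
  i*i≡+∣i∣*∣i∣ (ℤ.+ n)    = sym (ℤ.pos-* n n)
  i*i≡+∣i∣*∣i∣ ℤ.-[1+ n ] = refl

  ℕ→ℚ-∣i∣*∣i∣ : ∀ i → ℕ→ℚ (ℤ.∣ i ∣ ℕ.* ℤ.∣ i ∣) ≡ ℤ→ℚ i * ℤ→ℚ i
  ℕ→ℚ-∣i∣*∣i∣ i = trans (cong ℤ→ℚ (sym (i*i≡+∣i∣*∣i∣ i))) (ℤ→ℚ-* i i)

  noSolution⇒noIntegralSolution : ∀ {n C} → NoSolution n C → ∀ X Y Z → Z ≢ ℤ.0ℤ →
                                  ℤ→ℚ X * ℤ→ℚ X + ℕ→ℚ n * (ℤ→ℚ Y * ℤ→ℚ Y) ≢ ℕ→ℚ C * (ℤ→ℚ Z * ℤ→ℚ Z)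
  noSolution⇒noIntegralSolution {n} {C} no-solution X Y Z Z≢0 eq =
    no-solution ℤ.∣ X ∣ ℤ.∣ Y ∣ ℤ.∣ Z ∣ (Z≢0 ∘ ℤ.∣i∣≡0⇒i≡0) (ℕ→ℚ-injective (begin
      ℕ→ℚ (∣ X ∣² ℕ.+ n ℕ.* ∣ Y ∣²)              ≡⟨ ℕ→ℚ-+ ∣ X ∣² (n ℕ.* ∣ Y ∣²) ⟩
      ℕ→ℚ ∣ X ∣² + ℕ→ℚ (n ℕ.* ∣ Y ∣²)            ≡⟨ cong (ℕ→ℚ ∣ X ∣² +_) (ℕ→ℚ-* n ∣ Y ∣²) ⟩
      ℕ→ℚ ∣ X ∣² + ℕ→ℚ n * ℕ→ℚ ∣ Y ∣²            ≡⟨ cong₂ (λ x y → x + ℕ→ℚ n * y) (ℕ→ℚ-∣i∣*∣i∣ X) (ℕ→ℚ-∣i∣*∣i∣ Y) ⟩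
      ℤ→ℚ X * ℤ→ℚ X + ℕ→ℚ n * (ℤ→ℚ Y * ℤ→ℚ Y) ≡⟨ eq ⟩
      ℕ→ℚ C * (ℤ→ℚ Z * ℤ→ℚ Z)                   ≡⟨ cong (ℕ→ℚ C *_) (ℕ→ℚ-∣i∣*∣i∣ Z) ⟨
      ℕ→ℚ C * ℕ→ℚ ∣ Z ∣²                         ≡⟨ ℕ→ℚ-* C ∣ Z ∣² ⟨
      ℕ→ℚ (C ℕ.* ∣ Z ∣²)                         ∎))
    where
    open ≡-Reasoning
    ∣_∣² : ℤ → ℕ
    ∣ i ∣² = ℤ.∣ i ∣ ℕ.* ℤ.∣ i ∣

  ℤ→ℚ-↥↧↧ : ∀ a b c → ℤ→ℚ (↥ a ℤ.* ↧ b ℤ.* ↧ c) ≡ a * ℤ→ℚ (↧ a) * ℤ→ℚ (↧ b) * ℤ→ℚ (↧ c)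
  ℤ→ℚ-↥↧↧ a b c = begin
    ℤ→ℚ (↥ a ℤ.* ↧ b ℤ.* ↧ c)             ≡⟨ ℤ→ℚ-* (↥ a ℤ.* ↧ b) (↧ c) ⟩
    ℤ→ℚ (↥ a ℤ.* ↧ b) * ℤ→ℚ (↧ c)         ≡⟨ cong (_* ℤ→ℚ (↧ c)) (ℤ→ℚ-* (↥ a) (↧ b)) ⟩
    ℤ→ℚ (↥ a) * ℤ→ℚ (↧ b) * ℤ→ℚ (↧ c)     ≡⟨ cong (λ t → t * ℤ→ℚ (↧ b) * ℤ→ℚ (↧ c)) (*↧≡↥ a) ⟨
    a * ℤ→ℚ (↧ a) * ℤ→ℚ (↧ b) * ℤ→ℚ (↧ c) ∎
    where open ≡-Reasoning

  noSolution⇒noRationalSolution : ∀ {n C} → NoSolution n C → ∀ u v w → w ≢ 0ℚ →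
                                  u * u + ℕ→ℚ n * (v * v) ≢ ℕ→ℚ C * (w * w)
  noSolution⇒noRationalSolution {n} {C} no-solution u v w w≢0 eq =
    noSolution⇒noIntegralSolution {n} {C} no-solution X Y Z Z≢0 (begin
      ℤ→ℚ X * ℤ→ℚ X + ℕ→ℚ n * (ℤ→ℚ Y * ℤ→ℚ Y)
        ≡⟨ cong₂ (λ x y → x * x + ℕ→ℚ n * (y * y)) (ℤ→ℚ-↥↧↧ u v w) (ℤ→ℚ-↥↧↧ v u w) ⟩
      u * du * dv * dw * (u * du * dv * dw) + ℕ→ℚ n * (v * dv * du * dw * (v * dv * du * dw))
        ≡⟨ solve 6 (λ u v n du dv dw →
             u :* du :* dv :* dw :* (u :* du :* dv :* dw) :+ n :* (v :* dv :* du :* dw :* (v :* dv :* du :* dw))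
             := (du :* dv :* dw) :* (du :* dv :* dw) :* (u :* u :+ n :* (v :* v))) refl u v (ℕ→ℚ n) du dv dw ⟩
      (du * dv * dw) * (du * dv * dw) * (u * u + ℕ→ℚ n * (v * v))
        ≡⟨ cong ((du * dv * dw) * (du * dv * dw) *_) eq ⟩
      (du * dv * dw) * (du * dv * dw) * (ℕ→ℚ C * (w * w))
        ≡⟨ solve 5 (λ w C du dv dw →
             (du :* dv :* dw) :* (du :* dv :* dw) :* (C :* (w :* w))
             := C :* (w :* dw :* du :* dv :* (w :* dw :* du :* dv))) refl w (ℕ→ℚ C) du dv dw ⟩
      ℕ→ℚ C * (w * dw * du * dv * (w * dw * du * dv))
        ≡⟨ cong (λ z → ℕ→ℚ C * (z * z)) (ℤ→ℚ-↥↧↧ w u v) ⟨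
      ℕ→ℚ C * (ℤ→ℚ Z * ℤ→ℚ Z) ∎)
    where
    open ≡-Reasoning
    X Y Z : ℤ
    X = ↥ u ℤ.* ↧ v ℤ.* ↧ w
    Y = ↥ v ℤ.* ↧ u ℤ.* ↧ w
    Z = ↥ w ℤ.* ↧ u ℤ.* ↧ v
    du dv dw : ℚ
    du = ℤ→ℚ (↧ u)
    dv = ℤ→ℚ (↧ v)
    dw = ℤ→ℚ (↧ w)
    Z≢0 : Z ≢ ℤ.0ℤ
    Z≢0 = ℕ.≢-nonZero⁻¹ ℤ.∣ Z ∣ ∘ cong ℤ.∣_∣
      where
      instance
        ↥w≢0 : ℤ.NonZero (↥ w)
        ↥w≢0 = ℤ.≢-nonZero (w≢0 ∘ ℚ.↥p≡0⇒p≡0 w)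
        ↥w↧u≢0 : ℤ.NonZero (↥ w ℤ.* ↧ u)
        ↥w↧u≢0 = ℤ.i*j≢0 (↥ w) (↧ u)
        ↥w↧u↧v≢0 : ℤ.NonZero Z
        ↥w↧u↧v≢0 = ℤ.i*j≢0 (↥ w ℤ.* ↧ u) (↧ v)

open Rationals

module QuadraticSpaces where
  open import Data.Rational using (½; 0ℚ; 1ℚ; _+_; _*_; _-_; -_)
  import Data.Rational.Properties as ℚ
  open import Data.Rational.Solver using (module +-*-Solver)
  open import Relation.Binary.PropositionalEquality
  open +-*-Solver

  module QuadraticForm {m ℓ : Level} (V : ℚ-Module m ℓ) {Q : LeftModule.Carrierᴹ V → ℚ}
                       (isQuadratic : IsQuadraticForm V Q) where
    open LeftModule V
    open IsQuadraticForm isQuadratic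

    Q≡polar : ∀ v → Q v ≡ polar V Q v v
    Q≡polar v = sym (begin
      ½ * ((Q (v +ᴹ v) - Q v) - Q v)                    ≡⟨ cong (λ t → ½ * ((t - Q v) - Q v)) (Q-cong v+v≈2v) ⟩
      ½ * ((Q ((1ℚ + 1ℚ) *ₗ v) - Q v) - Q v)            ≡⟨ cong (λ t → ½ * ((t - Q v) - Q v)) (Q-scale (1ℚ + 1ℚ) v) ⟩
      ½ * ((((1ℚ + 1ℚ) * (1ℚ + 1ℚ)) * Q v - Q v) - Q v)
        ≡⟨ solve 1 (λ q → con ½ :* ((((con 1ℚ :+ con 1ℚ) :* (con 1ℚ :+ con 1ℚ)) :* q :- q) :- q) := q) refl (Q v) ⟩
      Q v                                               ∎)
      where
      open ≡-Reasoning
      v+v≈2v : (v +ᴹ v) ≈ᴹ ((1ℚ + 1ℚ) *ₗ v)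
      v+v≈2v = ≈ᴹ-sym (≈ᴹ-trans (*ₗ-distribʳ v 1ℚ 1ℚ) (+ᴹ-cong (*ₗ-identityˡ v) (*ₗ-identityˡ v)))

    polar-sym : ∀ v w → polar V Q v w ≡ polar V Q w v
    polar-sym v w = begin
      ½ * ((Q (v +ᴹ w) - Q v) - Q w) ≡⟨ cong (λ t → ½ * ((t - Q v) - Q w)) (Q-cong (+ᴹ-comm v w)) ⟩
      ½ * ((Q (w +ᴹ v) - Q v) - Q w)
        ≡⟨ solve 3 (λ t a b → con ½ :* ((t :- a) :- b) := con ½ :* ((t :- b) :- a)) refl (Q (w +ᴹ v)) (Q v) (Q w) ⟩
      ½ * ((Q (w +ᴹ v) - Q w) - Q v) ∎
      where open ≡-Reasoning

    Q-lincomb : ∀ a b u v → Q ((a *ₗ u) +ᴹ (b *ₗ v)) ≡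
                a * (a * polar V Q u u + b * polar V Q v u) + b * (a * polar V Q u v + b * polar V Q v v)
    Q-lincomb a b u v = begin
      Q z                                             ≡⟨ Q≡polar z ⟩
      polar V Q z z                                   ≡⟨ B-linear a b u v z ⟩
      a * polar V Q u z + b * polar V Q v z           ≡⟨ cong₂ (λ s t → a * s + b * t)
                                                           (trans (polar-sym u z) (B-linear a b u v u))
                                                           (trans (polar-sym v z) (B-linear a b u v v)) ⟩
      a * (a * polar V Q u u + b * polar V Q v u) + b * (a * polar V Q u v + b * polar V Q v v) ∎
      where
      open ≡-Reasoning
      z : Carrierᴹ
      z = (a *ₗ u) +ᴹ (b *ₗ v)

  completing-square : ∀ a b g s h → g * (a * (a * g + b * s) + b * (a * s + b * h)) ≡
                      (g * a + s * b) * (g * a + s * b) + (g * h - s * s) * (b * b)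
  completing-square = solve 5 (λ a b g s h →
    g :* (a :* (a :* g :+ b :* s) :+ b :* (a :* s :+ b :* h)) :=
    (g :* a :+ s :* b) :* (g :* a :+ s :* b) :+ (g :* h :- s :* s) :* (b :* b)) refl

  0<i*j⇒j≡+n : ∀ {i} j → ℤ.0ℤ ℤ.< i → ℤ.0ℤ ℤ.< i ℤ.* j → ∃[ n ] j ≡ ℤ.+ n
  0<i*j⇒j≡+n (ℤ.+ n)                    _            _  = n , refl
  0<i*j⇒j≡+n {ℤ.+[1+ _ ]} ℤ.-[1+ _ ] _            ()
  0<i*j⇒j≡+n {ℤ.+0}       ℤ.-[1+ _ ] (ℤ.+<+ ()) _

  module GramMatrix {m ℓ : Level} (V : ℚ-Module m ℓ) (Q : LeftModule.Carrierᴹ V → ℚ)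
                    (isQS : IsPosDefQuadraticSpace V Q) (x : Fin 2 → LeftModule.Carrierᴹ V)
                    (independent : LinearlyIndependent₂ V (x f0) (x (fs f0)))
                    (G : Fin 2 → Fin 2 → ℤ) (gram : ∀ i j → polar V Q (x i) (x j) ≡ ℤ→ℚ (G i j)) where
    open LeftModule V
    open IsPosDefQuadraticSpace isQS
    open QuadraticForm V quadratic

    private
      x₁ x₂ : Carrierᴹ
      x₁ = x f0
      x₂ = x (fs f0)
      g s h : ℚ
      g = ℤ→ℚ (G f0 f0)
      s = ℤ→ℚ (G f0 (fs f0))
      h = ℤ→ℚ (G (fs f0) (fs f0))

    gram-sym : ℤ→ℚ (G (fs f0) f0) ≡ s
    gram-sym = trans (sym (gram (fs f0) f0)) (trans (polar-sym x₂ x₁) (gram f0 (fs f0)))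

    Q-span : ∀ a b → Q ((a *ₗ x₁) +ᴹ (b *ₗ x₂)) ≡ a * (a * g + b * s) + b * (a * s + b * h)
    Q-span a b = trans (Q-lincomb a b x₁ x₂)
      (cong₂ (λ u v → a * u + b * v)
        (cong₂ (λ u v → a * u + b * v) (gram f0 f0) (trans (gram (fs f0) f0) gram-sym))
        (cong₂ (λ u v → a * u + b * v) (gram f0 (fs f0)) (gram (fs f0) (fs f0))))

    Q-x₁ : Q x₁ ≡ g
    Q-x₁ = trans (Q≡polar x₁) (gram f0 f0)

    ℤ→ℚ-det : ℤ→ℚ (det₂ G) ≡ g * h - s * s
    ℤ→ℚ-det = begin
      ℤ→ℚ (det₂ G)
        ≡⟨ ℤ→ℚ-minus (G f0 f0 ℤ.* G (fs f0) (fs f0)) (G f0 (fs f0) ℤ.* G (fs f0) f0) ⟩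
      ℤ→ℚ (G f0 f0 ℤ.* G (fs f0) (fs f0)) - ℤ→ℚ (G f0 (fs f0) ℤ.* G (fs f0) f0)
        ≡⟨ cong₂ _-_ (ℤ→ℚ-* (G f0 f0) (G (fs f0) (fs f0)))
                     (trans (ℤ→ℚ-* (G f0 (fs f0)) (G (fs f0) f0)) (cong (s *_) gram-sym)) ⟩
      g * h - s * s                               ∎
      where open ≡-Reasoning

    0<g : 0ℚ ℚ.< g
    0<g = subst (0ℚ ℚ.<_) Q-x₁ (posDefinite x₁ x₁≉0)
      where
      x₁≉0 : ¬ (x₁ ≈ᴹ 0ᴹ)
      x₁≉0 x₁≈0 with independent 1ℚ 0ℚ
        (≈ᴹ-trans (+ᴹ-cong (≈ᴹ-trans (*ₗ-identityˡ x₁) x₁≈0) (*ₗ-zeroˡ x₂)) (+ᴹ-identityˡ 0ᴹ))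
      ... | () , _

    det≡+n : ∃[ n ] det₂ G ≡ ℤ.+ n
    det≡+n = 0<i*j⇒j≡+n (det₂ G) (ℤ→ℚ-cancel-< (G f0 f0) 0<g)
      (ℤ→ℚ-cancel-< (G f0 f0 ℤ.* det₂ G) (subst (0ℚ ℚ.<_) Q-v≡g*det (posDefinite v v≉0)))
      where
      v : Carrierᴹ
      v = (s *ₗ x₁) +ᴹ ((- g) *ₗ x₂)
      v≉0 : ¬ (v ≈ᴹ 0ᴹ)
      v≉0 v≈0 = ℚ.<-irrefl (sym (ℚ.neg-injective (proj₂ (independent s (- g) v≈0)))) 0<g
      Q-v≡g*det : Q v ≡ ℤ→ℚ (G f0 f0 ℤ.* det₂ G)
      Q-v≡g*det = begin
        Q v                                         ≡⟨ Q-span s (- g) ⟩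
        s * (s * g + (- g) * s) + (- g) * (s * s + (- g) * h)
          ≡⟨ solve 3 (λ g s h → s :* (s :* g :+ (:- g) :* s) :+ (:- g) :* (s :* s :+ (:- g) :* h)
                                := g :* (g :* h :- s :* s)) refl g s h ⟩
        g * (g * h - s * s)                         ≡⟨ cong (g *_) ℤ→ℚ-det ⟨
        g * ℤ→ℚ (det₂ G)                            ≡⟨ ℤ→ℚ-* (G f0 f0) (det₂ G) ⟨
        ℤ→ℚ (G f0 f0 ℤ.* det₂ G)                    ∎
        where open ≡-Reasoning

    noSolution⇒¬represented : ∀ {n C} → det₂ G ≡ ℤ.+ n → NoSolution n C →
                              ¬ RepresentedBySpan V Q x₁ x₂ (ℕ→ℚ C * Q x₁)
    noSolution⇒¬represented {n} {C} det≡n no-solution (a , b , represented) =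
      noSolution⇒noRationalSolution {n} {C} no-solution (g * a + s * b) b g g≢0 (begin
        (g * a + s * b) * (g * a + s * b) + ℕ→ℚ n * (b * b)
          ≡⟨ cong (λ d → (g * a + s * b) * (g * a + s * b) + d * (b * b)) (trans (cong ℤ→ℚ (sym det≡n)) ℤ→ℚ-det) ⟩
        (g * a + s * b) * (g * a + s * b) + (g * h - s * s) * (b * b)
          ≡⟨ completing-square a b g s h ⟨
        g * (a * (a * g + b * s) + b * (a * s + b * h)) ≡⟨ cong (g *_) (trans (sym (Q-span a b)) represented) ⟩
        g * (ℕ→ℚ C * Q x₁)                              ≡⟨ cong (λ q → g * (ℕ→ℚ C * q)) Q-x₁ ⟩
        g * (ℕ→ℚ C * g)                                 ≡⟨ solve 2 (λ g c → g :* (c :* g) := c :* (g :* g)) refl g (ℕ→ℚ C) ⟩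
        ℕ→ℚ C * (g * g)                                 ∎)
      where
      open ≡-Reasoning
      g≢0 : g ≢ 0ℚ
      g≢0 g≡0 = ℚ.<-irrefl (sym g≡0) 0<g

open QuadraticSpaces

lemma4p4 : {m ℓ : Level} (V : ℚ-Module m ℓ) (Q : LeftModule.Carrierᴹ V → ℚ) →
    IsPosDefQuadraticSpace V Q →
    (x : Fin 2 → LeftModule.Carrierᴹ V) →
    LinearlyIndependent₂ V (x f0) (x (fs f0)) →
    (G : Fin 2 → Fin 2 → ℤ) →
    (∀ i j → polar V Q (x i) (x j) ≡ ℤ→ℚ (G i j)) →
    (∃[ C ] ((0 ℕ.< C) × ¬ RepresentedBySpan V Q (x f0) (x (fs f0)) (ℕ→ℚ C ℚ.* Q (x f0))))
    × (IsSquareℤ (det₂ G) → ¬ RepresentedBySpan V Q (x f0) (x (fs f0)) (ℕ→ℚ 3 ℚ.* Q (x f0)))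
    × (∀ p → Prime p → p ≢ 2 → OddValuation p (det₂ G) → ∀ g → IsLeastQNR p g →
         ¬ RepresentedBySpan V Q (x f0) (x (fs f0)) (ℕ→ℚ g ℚ.* Q (x f0)))
    × (OddValuation 2 (det₂ G) → ¬ RepresentedBySpan V Q (x f0) (x (fs f0)) (ℕ→ℚ 5 ℚ.* Q (x f0)))
lemma4p4 V Q isQS x independent G gram = some-C , square-case , odd-prime-case , two-case
  where
  open GramMatrix V Q isQS x independent G gram
  Unrepresented : ℕ → Set
  Unrepresented C = ¬ RepresentedBySpan V Q (x f0) (x (fs f0)) (ℕ→ℚ C ℚ.* Q (x f0))
  n : ℕ
  n = proj₁ det≡+n
  det≡n : det₂ G ≡ ℤ.+ n
  det≡n = proj₂ det≡+n
  unrepresented : ∀ C → NoSolution n C → Unrepresented C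
  unrepresented C = noSolution⇒¬represented {n} {C} det≡n
  some-C : ∃[ C ] ((0 ℕ.< C) × Unrepresented C)
  some-C = let C , 0<C , no-solution = ∃-noSolution n in C , 0<C , unrepresented C no-solution
  square-case : IsSquareℤ (det₂ G) → Unrepresented 3
  square-case (k , det≡k²) =
    unrepresented 3 (subst (λ K → NoSolution K 3) (sym n≡∣k∣²) (noSolution-square-3 ℤ.∣ k ∣))
    where
    n≡∣k∣² : n ≡ ℤ.∣ k ∣ ℕ.* ℤ.∣ k ∣
    n≡∣k∣² = trans (cong ℤ.∣_∣ (trans (sym det≡n) det≡k²)) (ℤ.abs-* k k)
  odd-prime-case : ∀ p → Prime p → p ≢ 2 → OddValuation p (det₂ G) → ∀ g → IsLeastQNR p g → Unrepresented g
  odd-prime-case p pp _ ν-odd g (_ , g-nonresidue , _) = unrepresented g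
    (noSolution-nonResidue pp (oddValuation⇒oddMultiplicity (subst (OddValuation p) det≡n ν-odd)) g-nonresidue)
  two-case : OddValuation 2 (det₂ G) → Unrepresented 5
  two-case ν-odd = unrepresented 5 (noSolution-2-5 (oddValuation⇒oddMultiplicity (subst (OddValuation 2) det≡n ν-odd)))
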